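{- For every integer $d\ge2$ there is a constant $c_d>0$ such that for any plane tree $t$ and any node $u\in t$, if $\theta_ut$ is $d$-ary and $|\theta_ut|\le\frac13|t|$, then $\big|\{v\in\theta_ut:\varphi_t(\varnothing)\ge\varphi_t(u*v)\}\big|\le\exp\big(c_d+c_d\sqrt{\log\Phi(t)}\big)$.
   Context: $\mathbb{U}$ is the set of finite words over $\{1,2,\dots\}$ with empty word $\varnothing$; $u*v$ is concatenation; for $u\ne\varnothing$, $\overleftarrow u$ is $u$ with its last letter removed; $u\preceq v$ means $u$ is a prefix of $v$. A plane tree is a finite $t\subset\mathbb{U}$ with $\varnothing\in t$, $\overleftarrow u\in t$ for all $u\in t\setminus\{\varnothing\}$, and such that for each $u\in t$ there is $k_u(t)\ge0$ with $u*j\in t\iff1\le j\le k_u(t)$. It is viewed as a graph tree rooted at $\varnothing$ with edges $\{\overleftarrow u,u\}$. For $u\in t$, $\theta_ut=\{v:u*v\in t\}$ (a plane tree). A plane tree is $d$-ary if $k_u(t)\in\{0,d\}$ for all $u\in t$. Centrality: $\varphi_t(u)=\prod_{v\in t,\,v\not\preceq u}|\theta_vt|\cdot\prod_{v\in t,\,\varnothing\ne v\preceq u}(|t|-|\theta_vt|)$ (equivalently, the product over $v\ne u$ of the sizes of the subtrees rooted at $v$ when $t$ is rooted at $u$). Competitive ratio: $\Phi(t)=\varphi_t(\varnothing)/\min_{w\in t}\varphi_t(w)$. -}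

module Defs where

open import Data.Nat using (ℕ; zero; suc; _+_; _*_; _∸_; _^_; _≤_; _≤?_; _⊓_)
open import Data.Bool using (Bool; true; false; _∧_; _∨_; not)
open import Data.List using (List; []; _∷_; _++_; map; length; filter; foldr)
open import Data.Nat.ListAction using (product)
open import Data.List.Membership.Propositional using (_∈_)
open import Data.Sum using (_⊎_)
open import Relation.Binary.PropositionalEquality using (_≡_)

-- Words over {1,2,...}: lists of naturals (letters used are always ≥ 1).
Word : Set
Word = List ℕ

-- Plane trees, represented as ordered rooted trees; the set of nodes
-- (Ulam–Harris words) of a tree is given by `nodes` below.
data Tree : Set where
  node : List Tree → Tree

leaf : Tree
leaf = node []

kids : Tree → ℕ
kids (node ts) = length ts

mutual
  -- the set t ⊂ 𝕌 of words of a plane tree (as a duplicate-free list)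
  nodes : Tree → List Word
  nodes (node ts) = [] ∷ nodesL 1 ts

  nodesL : ℕ → List Tree → List Word
  nodesL i [] = []
  nodesL i (t ∷ ts) = map (i ∷_) (nodes t) ++ nodesL (suc i) ts

size : Tree → ℕ
size t = length (nodes t)

mutual
  -- θ_u t (meaningful for u ∈ nodes t; a leaf otherwise)
  θ : Word → Tree → Tree
  θ [] t = t
  θ (j ∷ w) (node ts) = θL j w ts

  θL : ℕ → Word → List Tree → Tree
  θL _ _ [] = leaf
  θL zero _ (_ ∷ _) = leaf
  θL (suc zero) w (t ∷ ts) = θ w t
  θL (suc (suc j)) w (t ∷ ts) = θL (suc j) w ts

eqℕ : ℕ → ℕ → Bool
eqℕ zero zero = true
eqℕ zero (suc _) = false
eqℕ (suc _) zero = false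
eqℕ (suc m) (suc n) = eqℕ m n

prefix? : Word → Word → Bool
prefix? [] _ = true
prefix? (_ ∷ _) [] = false
prefix? (a ∷ u) (b ∷ v) = eqℕ a b ∧ prefix? u v

isEmpty : Word → Bool
isEmpty [] = true
isEmpty (_ ∷ _) = false

factor : Tree → Word → Word → ℕ
factor t u v with prefix? v u
... | false = size (θ v t)
... | true with isEmpty v
...   | true = 1
...   | false = size t ∸ size (θ v t)

-- centrality φ_t(u) = ∏_{v ∉ [∅,u]} |θ_v t| · ∏_{∅ ≠ v ⪯ u} (|t| - |θ_v t|)
φ : Tree → Word → ℕ
φ t u = product (map (factor t u) (nodes t))

minφ : Tree → ℕ
minφ t = foldr _⊓_ (φ t []) (map (φ t) (nodes t))

IsDAry : ℕ → Tree → Set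
IsDAry d t = ∀ v → v ∈ nodes t → (kids (θ v t) ≡ 0) ⊎ (kids (θ v t) ≡ d)

countBelowRoot : Tree → Word → ℕ
countBelowRoot t u =
  length (filter (λ v → φ t (u ++ v) ≤? φ t []) (nodes (θ u t)))

{-# OPTIONS --safe #-}

-- Let T = θ u t, a = |T| and n = |t| ≥ 3a. Going down from u to u*v multiplies the centrality by
-- the product of (n − s)/s over the subtrees θ (u*w) t of size s along the path (φ-++). As s ≤ a,
-- each factor is at least 2a/s ≥ 2, and after L light steps (into a child holding at most half of
-- its parent) s ≤ a/2^L, so the next factor is at least 2^(L+1). Hence φ(u*v) ≤ φ(∅) ≤ 2^(m²)·φ(u)
-- makes the path to v payable from a budget of m² when a step at level L costs L + 1.
--
-- Such paths are counted by induction on T against the potential V·pot(b)/C(K+L, L), K = 4d(m+1).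
-- At most one child is heavy; it keeps the level and spends L + 1 from the budget, which pot absorbs
-- as pot(b) − pot(b − L − 1) ≥ (L + 1)·Δpot. The at most d light children raise the level, which
-- shrinks the potential by K/(L+1) while pot ≤ 2(m+1)·Δpot. Since pot(m²) = 2^O(m), the number of
-- such v is at most C^(m+1).

module Submission where

open import Defs
open import Data.Nat using (ℕ; zero; suc; _+_; _*_; _^_; _≤_; _<_; _∸_; _⊓_; z≤n; s≤s; NonZero; >-nonZero; >-nonZero⁻¹; ≢-nonZero; _≟_; _≤?_; _!)
open import Data.Nat.Properties
open import Data.Nat.ListAction using (sum; product)
open import Data.Nat.Tactic.RingSolver using (solve-∀)
open import Data.Bool using (Bool; true; false; _∧_; if_then_else_)
open import Data.Bool.Properties using (∧-zeroʳ)
open import Data.List using (List; []; _∷_; _++_; _∷ʳ_; map; length; filter; foldr)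
open import Data.List.Properties using (++-assoc; ++-identityʳ; length-++; length-++-comm; length-map; ∷-injectiveʳ)
open import Data.List.Membership.Propositional using (_∈_)
open import Data.List.Membership.Propositional.Properties using (∈-++⁻; ∈-++⁺ˡ; ∈-++⁺ʳ; ∈-map⁻; ∈-map⁺)
open import Data.List.Relation.Unary.Any using (here; there)
open import Data.List.Relation.Unary.All as All using (All; []; _∷_)
import Data.List.Relation.Unary.All.Properties as All
open import Data.List.Relation.Unary.AllPairs using ([]; _∷_)
open import Data.List.Relation.Unary.Unique.Propositional using (Unique)
import Data.List.Relation.Unary.Unique.Propositional.Properties as Unique
open import Data.Product using (Σ; ∃-syntax; _×_; _,_; proj₁; proj₂)
open import Data.Sum using (inj₁; inj₂)
open import Data.Empty using (⊥; ⊥-elim)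
open import Level using (0ℓ)
open import Relation.Nullary using (yes; no; does; ¬_; contradiction)
open import Relation.Nullary.Decidable using (dec-true; dec-false)
open import Relation.Unary using (Pred; Decidable)
open import Relation.Binary.PropositionalEquality
open import Algebra.Properties.CommutativeSemigroup +-commutativeSemigroup
  using () renaming (x∙yz≈xz∙y to x+[y+z]≡x+z+y)
open import Algebra.Properties.CommutativeSemigroup *-commutativeSemigroup
  using (x∙yz≈y∙xz; x∙yz≈yx∙z; xy∙z≈y∙xz; xy∙z≈zy∙x)

count : {A : Set} → (A → Bool) → List A → ℕ
count p [] = 0
count p (x ∷ xs) = if p x then suc (count p xs) else count p xs

count-++ : {A : Set} (p : A → Bool) (xs ys : List A) → count p (xs ++ ys) ≡ count p xs + count p ys
count-++ p [] ys = refl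
count-++ p (x ∷ xs) ys with p x
... | true = cong suc (count-++ p xs ys)
... | false = count-++ p xs ys

count-map : {A B : Set} (p : B → Bool) (f : A → B) (xs : List A) → count p (map f xs) ≡ count (λ x → p (f x)) xs
count-map p f [] = refl
count-map p f (x ∷ xs) with p (f x)
... | true = cong suc (count-map p f xs)
... | false = count-map p f xs

count-cong : {A : Set} {p q : A → Bool} → (∀ x → p x ≡ q x) → (xs : List A) → count p xs ≡ count q xs
count-cong e [] = refl
count-cong {q = q} e (x ∷ xs) rewrite e x with q x
... | true = cong suc (count-cong e xs)
... | false = count-cong e xs

count-none : {A : Set} {p : A → Bool} {xs : List A} → All (λ x → p x ≡ false) xs → count p xs ≡ 0
count-none [] = refl
count-none {p = p} {x ∷ _} (px≡false ∷ pxs≡false) rewrite px≡false = count-none pxs≡false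

count-∧ʳ : {A : Set} (p q : A → Bool) (xs : List A) → count (λ x → p x ∧ q x) xs ≤ count q xs
count-∧ʳ p q [] = z≤n
count-∧ʳ p q (x ∷ xs) with p x | q x
... | true | true = s≤s (count-∧ʳ p q xs)
... | true | false = count-∧ʳ p q xs
... | false | true = m≤n⇒m≤1+n (count-∧ʳ p q xs)
... | false | false = count-∧ʳ p q xs

length-filter≤count : {A : Set} {P : Pred A 0ℓ} (P? : Decidable P) (p : A → Bool) (xs : List A) →
  (∀ x → x ∈ xs → P x → p x ≡ true) → length (filter P? xs) ≤ count p xs
length-filter≤count P? p [] _ = z≤n
length-filter≤count P? p (x ∷ xs) P⇒p with P? x | p x in px
... | yes Px | true = s≤s (length-filter≤count P? p xs (λ y y∈ → P⇒p y (there y∈)))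
... | yes Px | false = contradiction (trans (sym px) (P⇒p x (here refl) Px)) λ ()
... | no _ | true = m≤n⇒m≤1+n (length-filter≤count P? p xs (λ y y∈ → P⇒p y (there y∈)))
... | no _ | false = length-filter≤count P? p xs (λ y y∈ → P⇒p y (there y∈))

sum-map-bound : {A : Set} (f h : A → ℕ) (z α β : ℕ) (xs : List A) → All (λ x → f x * z ≤ h x * α + β) xs →
  sum (map f xs) * z ≤ sum (map h xs) * α + length xs * β
sum-map-bound f h z α β [] [] = z≤n
sum-map-bound f h z α β (x ∷ xs) (fx≤ ∷ fxs≤) = begin
    (f x + sum (map f xs)) * z                              ≡⟨ *-distribʳ-+ z (f x) _ ⟩
    f x * z + sum (map f xs) * z                            ≤⟨ +-mono-≤ fx≤ (sum-map-bound f h z α β xs fxs≤) ⟩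
    (h x * α + β) + (sum (map h xs) * α + length xs * β)    ≡⟨ regroup (h x) (sum (map h xs)) (length xs) α β ⟩
    (h x + sum (map h xs)) * α + suc (length xs) * β        ∎
  where
  open ≤-Reasoning
  regroup : ∀ a s l α β → (a * α + β) + (s * α + l * β) ≡ (a + s) * α + suc l * β
  regroup = solve-∀

product-map≥1 : {A : Set} (f : A → ℕ) (xs : List A) → (∀ x → x ∈ xs → 1 ≤ f x) → 1 ≤ product (map f xs)
product-map≥1 f [] _ = ≤-refl
product-map≥1 f (x ∷ xs) f≥1 = *-mono-≤ (f≥1 x (here refl)) (product-map≥1 f xs (λ y y∈ → f≥1 y (there y∈)))

foldr-⊓-map≤ : {A : Set} (f : A → ℕ) (z : ℕ) {x : A} {xs : List A} → x ∈ xs → foldr _⊓_ z (map f xs) ≤ f x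
foldr-⊓-map≤ f z {xs = y ∷ _} (here refl) = m⊓n≤m (f y) _
foldr-⊓-map≤ f z {xs = y ∷ _} (there x∈) = ≤-trans (m⊓n≤n (f y) _) (foldr-⊓-map≤ f z x∈)

2^m≤2^n⇒m≤n : ∀ {m n} → 2 ^ m ≤ 2 ^ n → m ≤ n
2^m≤2^n⇒m≤n {m} {n} 2^m≤2^n with m ≤? n
... | yes m≤n = m≤n
... | no m≰n = contradiction 2^m≤2^n (<⇒≱ (^-monoʳ-< 2 (s≤s (s≤s z≤n)) (≰⇒> m≰n)))

peel-factor : ∀ {s N k b p q} .{{_ : NonZero s}} .{{_ : NonZero q}} →
  2 ^ k * s ≤ N → q ≤ p → N * p ≤ 2 ^ b * (s * q) → k ≤ b × p ≤ 2 ^ (b ∸ k) * q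
peel-factor {s} {N} {k} {b} {p} {q} 2^k*s≤N q≤p N*p≤ = k≤b , p≤
  where
  2^k*p≤2^b*q : 2 ^ k * p ≤ 2 ^ b * q
  2^k*p≤2^b*q = *-cancelˡ-≤ s (begin
    s * (2 ^ k * p)       ≡⟨ x∙yz≈yx∙z s (2 ^ k) p ⟩
    2 ^ k * s * p         ≤⟨ *-monoˡ-≤ p 2^k*s≤N ⟩
    N * p                 ≤⟨ N*p≤ ⟩
    2 ^ b * (s * q)       ≡⟨ x∙yz≈y∙xz (2 ^ b) s q ⟩
    s * (2 ^ b * q)       ∎)
    where open ≤-Reasoning
  k≤b : k ≤ b
  k≤b = 2^m≤2^n⇒m≤n (*-cancelʳ-≤ (2 ^ k) (2 ^ b) q (≤-trans (*-monoʳ-≤ (2 ^ k) q≤p) 2^k*p≤2^b*q))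
  p≤ : p ≤ 2 ^ (b ∸ k) * q
  p≤ = *-cancelˡ-≤ (2 ^ k) {{m^n≢0 2 k}} (begin
    2 ^ k * p                   ≤⟨ 2^k*p≤2^b*q ⟩
    2 ^ b * q                   ≡⟨ cong (λ e → 2 ^ e * q) (m+[n∸m]≡n k≤b) ⟨
    2 ^ (k + (b ∸ k)) * q       ≡⟨ cong (_* q) (^-distribˡ-+-* 2 k (b ∸ k)) ⟩
    2 ^ k * 2 ^ (b ∸ k) * q     ≡⟨ *-assoc (2 ^ k) (2 ^ (b ∸ k)) q ⟩
    2 ^ k * (2 ^ (b ∸ k) * q)   ∎)
    where open ≤-Reasoning

n≤2^n : ∀ n → n ≤ 2 ^ n
n≤2^n zero = z≤n
n≤2^n (suc n) = begin
    suc n             ≤⟨ s≤s (n≤2^n n) ⟩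
    suc (2 ^ n)       ≤⟨ +-monoˡ-≤ (2 ^ n) (m^n>0 2 n) ⟩
    2 ^ n + 2 ^ n     ≡⟨ cong (2 ^ n +_) (+-identityʳ (2 ^ n)) ⟨
    2 * 2 ^ n         ∎
  where open ≤-Reasoning

[m+1+n]*o≡[m+n]*o+o : ∀ m n o → (m + suc n) * o ≡ (m + n) * o + o
[m+1+n]*o≡[m+n]*o+o m n o = trans (cong (_* o) (+-suc m n)) (+-comm o ((m + n) * o))

[m+n]!*[n+i]!≤[m+n+i]!*n! : ∀ m n i → (m + n) ! * (n + i) ! ≤ (m + (n + i)) ! * n !
[m+n]!*[n+i]!≤[m+n+i]!*n! m n zero rewrite +-identityʳ n = ≤-refl
[m+n]!*[n+i]!≤[m+n+i]!*n! m n (suc i) rewrite +-suc n i | +-suc m (n + i) = begin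
    (m + n) ! * (suc (n + i) * (n + i) !)             ≡⟨ x∙yz≈y∙xz ((m + n) !) (suc (n + i)) _ ⟩
    suc (n + i) * ((m + n) ! * (n + i) !)             ≤⟨ *-mono-≤ (s≤s (m≤n+m (n + i) m)) ([m+n]!*[n+i]!≤[m+n+i]!*n! m n i) ⟩
    suc (m + (n + i)) * ((m + (n + i)) ! * n !)       ≡⟨ *-assoc (suc (m + (n + i))) ((m + (n + i)) !) (n !) ⟨
    suc (m + (n + i)) * (m + (n + i)) ! * n !         ∎
  where open ≤-Reasoning

[m+m]!≤4^m*m!*m! : ∀ m → (m + m) ! ≤ 4 ^ m * (m ! * m !)
[m+m]!≤4^m*m!*m! zero = ≤-refl
[m+m]!≤4^m*m!*m! (suc m) rewrite +-suc m m = begin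
    suc (suc (m + m)) * (suc (m + m) * (m + m) !)
      ≤⟨ *-monoʳ-≤ (suc (suc (m + m))) (*-monoˡ-≤ ((m + m) !) (n≤1+n (suc (m + m)))) ⟩
    suc (suc (m + m)) * (suc (suc (m + m)) * (m + m) !)
      ≤⟨ *-monoʳ-≤ (suc (suc (m + m))) (*-monoʳ-≤ (suc (suc (m + m))) ([m+m]!≤4^m*m!*m! m)) ⟩
    suc (suc (m + m)) * (suc (suc (m + m)) * (4 ^ m * (m ! * m !)))
      ≡⟨ regroup m (4 ^ m) (m !) ⟩
    4 * 4 ^ m * (suc m * m ! * (suc m * m !))         ∎
  where
  open ≤-Reasoning
  regroup : ∀ m a f → suc (suc (m + m)) * (suc (suc (m + m)) * (a * (f * f))) ≡ 4 * a * (suc m * f * (suc m * f))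
  regroup = solve-∀

[m+n]!≤4^m*m!*n! : ∀ m n → n ≤ m → (m + n) ! ≤ 4 ^ m * (m ! * n !)
[m+n]!≤4^m*m!*n! m n n≤m = *-cancelʳ-≤ ((m + n) !) (4 ^ m * (m ! * n !)) (m !) {{m !≢0}} (begin
    (m + n) ! * m !                   ≡⟨ cong (λ x → (m + n) ! * x !) (m+[n∸m]≡n n≤m) ⟨
    (m + n) ! * (n + (m ∸ n)) !       ≤⟨ [m+n]!*[n+i]!≤[m+n+i]!*n! m n (m ∸ n) ⟩
    (m + (n + (m ∸ n))) ! * n !       ≡⟨ cong (λ x → (m + x) ! * n !) (m+[n∸m]≡n n≤m) ⟩
    (m + m) ! * n !                   ≤⟨ *-monoˡ-≤ (n !) ([m+m]!≤4^m*m!*m! m) ⟩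
    4 ^ m * (m ! * m !) * n !         ≡⟨ regroup (4 ^ m) (m !) (n !) ⟩
    4 ^ m * (m ! * n !) * m !         ∎)
  where
  open ≤-Reasoning
  regroup : ∀ a f g → a * (f * f) * g ≡ a * (f * g) * f
  regroup = solve-∀

-- Plane trees

size-node : ∀ ts → size (node ts) ≡ suc (sum (map size ts))
size-node ts = cong suc (length-nodesL 1 ts)
  where
  length-nodesL : ∀ i cs → length (nodesL i cs) ≡ sum (map size cs)
  length-nodesL i [] = refl
  length-nodesL i (c ∷ cs) = trans (length-++ (map (i ∷_) (nodes c)))
    (cong₂ _+_ (length-map (i ∷_) (nodes c)) (length-nodesL (suc i) cs))

size≥1 : ∀ T → 1 ≤ size T
size≥1 (node ts) = s≤s z≤n

root∈nodes : ∀ T → [] ∈ nodes T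
root∈nodes (node ts) = here refl

θL-at : ∀ pre w c cs → θL (suc (length pre)) w (pre ++ c ∷ cs) ≡ θ w c
θL-at [] w c cs = refl
θL-at (_ ∷ pre) w c cs = θL-at pre w c cs

∈-nodesL⁻ : ∀ i cs j w → (j ∷ w) ∈ nodesL (suc i) cs →
  ∃[ pre ] ∃[ c ] ∃[ cs′ ] cs ≡ pre ++ c ∷ cs′ × j ≡ suc (i + length pre) × w ∈ nodes c
∈-nodesL⁻ i (c ∷ cs) j w j∷w∈ with ∈-++⁻ (map (suc i ∷_) (nodes c)) j∷w∈
... | inj₁ ∈c with ∈-map⁻ (suc i ∷_) ∈c
...   | _ , w∈c , refl = [] , c , cs , refl , cong suc (sym (+-identityʳ i)) , w∈c
∈-nodesL⁻ i (c ∷ cs) j w _ | inj₂ ∈cs with ∈-nodesL⁻ (suc i) cs j w ∈cs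
...   | pre , c′ , cs′ , refl , refl , w∈c′ =
  c ∷ pre , c′ , cs′ , refl , cong suc (sym (+-suc i (length pre))) , w∈c′

∈-nodesL⁺ : ∀ i pre c cs w → w ∈ nodes c → (suc (i + length pre) ∷ w) ∈ nodesL (suc i) (pre ++ c ∷ cs)
∈-nodesL⁺ i [] c cs w w∈c rewrite +-identityʳ i = ∈-++⁺ˡ (∈-map⁺ (suc i ∷_) w∈c)
∈-nodesL⁺ i (p ∷ pre) c cs w w∈c rewrite +-suc i (length pre) =
  ∈-++⁺ʳ (map (suc i ∷_) (nodes p)) (∈-nodesL⁺ (suc i) pre c cs w w∈c)

∈-child⁻ : ∀ ts j w → (j ∷ w) ∈ nodes (node ts) → w ∈ nodes (θL j [] ts)
∈-child⁻ ts j w (there j∷w∈) with ∈-nodesL⁻ 0 ts j w j∷w∈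
... | pre , c , cs , refl , refl , w∈c = subst (λ c → w ∈ nodes c) (sym (θL-at pre [] c cs)) w∈c

∈-child⁺ : ∀ ts j w₀ w → (j ∷ w₀) ∈ nodes (node ts) → w ∈ nodes (θL j [] ts) → (j ∷ w) ∈ nodes (node ts)
∈-child⁺ ts j w₀ w (there j∷w₀∈) w∈ with ∈-nodesL⁻ 0 ts j w₀ j∷w₀∈
... | pre , c , cs , refl , refl , _ =
  there (∈-nodesL⁺ 0 pre c cs w (subst (λ c → w ∈ nodes c) (θL-at pre [] c cs) w∈))

θ-leaf : ∀ w → θ w leaf ≡ leaf
θ-leaf [] = refl
θ-leaf (_ ∷ _) = refl

mutual
  θ-++ : ∀ u w T → θ (u ++ w) T ≡ θ w (θ u T)
  θ-++ [] w T = refl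
  θ-++ (j ∷ u) w (node ts) = θL-++ j u w ts

  θL-++ : ∀ j u w ts → θL j (u ++ w) ts ≡ θ w (θL j u ts)
  θL-++ j u w [] = sym (θ-leaf w)
  θL-++ zero u w (_ ∷ _) = sym (θ-leaf w)
  θL-++ (suc zero) u w (t ∷ _) = θ-++ u w t
  θL-++ (suc (suc j)) u w (_ ∷ ts) = θL-++ (suc j) u w ts

∈-nodes-prefix : ∀ u w T → (u ++ w) ∈ nodes T → u ∈ nodes T
∈-nodes-prefix [] w T _ = root∈nodes T
∈-nodes-prefix (j ∷ u) w (node ts) j∷u++w∈ =
  ∈-child⁺ ts j (u ++ w) u j∷u++w∈ (∈-nodes-prefix u w (θL j [] ts) (∈-child⁻ ts j (u ++ w) j∷u++w∈))

++-∈-nodes⁺ : ∀ u w T → u ∈ nodes T → w ∈ nodes (θ u T) → (u ++ w) ∈ nodes T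
++-∈-nodes⁺ [] w T _ w∈ = w∈
++-∈-nodes⁺ (j ∷ u) w (node ts) j∷u∈ w∈ =
  ∈-child⁺ ts j u (u ++ w) j∷u∈
    (++-∈-nodes⁺ u w (θL j [] ts) (∈-child⁻ ts j u j∷u∈) (subst (λ T → w ∈ nodes T) (θL-++ j [] u ts) w∈))

mutual
  size-θ≤ : ∀ w T → size (θ w T) ≤ size T
  size-θ≤ [] T = ≤-refl
  size-θ≤ (j ∷ w) (node ts) = ≤-trans (size-θL≤ j w ts) (≤-reflexive (sym (size-node ts)))

  size-θL≤ : ∀ j w ts → size (θL j w ts) ≤ suc (sum (map size ts))
  size-θL≤ j w [] = ≤-refl
  size-θL≤ zero w (_ ∷ _) = s≤s z≤n
  size-θL≤ (suc zero) w (t ∷ ts) = ≤-trans (size-θ≤ w t) (≤-trans (m≤m+n (size t) _) (n≤1+n _))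
  size-θL≤ (suc (suc j)) w (t ∷ ts) = ≤-trans (size-θL≤ (suc j) w ts) (s≤s (m≤n+m _ (size t)))

StartsFrom : ℕ → Word → Set
StartsFrom i [] = ⊥
StartsFrom i (j ∷ _) = i ≤ j

nodesL-startsFrom : ∀ i cs → All (StartsFrom i) (nodesL i cs)
nodesL-startsFrom i [] = []
nodesL-startsFrom i (c ∷ cs) =
  All.++⁺ (All.map⁺ (All.tabulate (λ _ → ≤-refl))) (All.map weaken (nodesL-startsFrom (suc i) cs))
  where
  weaken : ∀ {w} → StartsFrom (suc i) w → StartsFrom i w
  weaken {_ ∷ _} i<j = ≤-trans (n≤1+n i) i<j

mutual
  nodes-unique : ∀ T → Unique (nodes T)
  nodes-unique (node ts) = All.map nonempty (nodesL-startsFrom 1 ts) ∷ nodesL-unique 1 ts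
    where
    nonempty : ∀ {w} → StartsFrom 1 w → [] ≢ w
    nonempty {_ ∷ _} _ ()

  nodesL-unique : ∀ i cs → Unique (nodesL i cs)
  nodesL-unique i [] = []
  nodesL-unique i (c ∷ cs) =
    Unique.++⁺ (Unique.map⁺ ∷-injectiveʳ (nodes-unique c)) (nodesL-unique (suc i) cs) disjoint
    where
    disjoint : ∀ {w} → w ∈ map (i ∷_) (nodes c) × w ∈ nodesL (suc i) cs → ⊥
    disjoint (w∈c , w∈cs) with ∈-map⁻ (i ∷_) w∈c
    ... | _ , _ , refl = 1+n≰n (All.lookup (nodesL-startsFrom (suc i) cs) w∈cs)

AllSubtrees : (Tree → Set) → Tree → Set
AllSubtrees P T = ∀ v → v ∈ nodes T → P (θ v T)

AllSubtrees-child : ∀ {P} pre c cs → AllSubtrees P (node (pre ++ c ∷ cs)) → AllSubtrees P c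
AllSubtrees-child {P} pre c cs all v v∈c =
  subst P (θL-at pre v c cs) (all (suc (length pre) ∷ v) (there (∈-nodesL⁺ 0 pre c cs v v∈c)))

AllSubtrees-children : ∀ {P} pre cs → AllSubtrees P (node (pre ++ cs)) → All (AllSubtrees P) cs
AllSubtrees-children pre [] _ = []
AllSubtrees-children {P} pre (c ∷ cs) all =
  AllSubtrees-child {P} pre c cs all ∷
  AllSubtrees-children {P} (pre ∷ʳ c) cs (subst (λ ts → AllSubtrees P (node ts)) (sym (++-assoc pre (c ∷ []) cs)) all)

IsDAry⇒kids≤ : ∀ d T → IsDAry d T → AllSubtrees (λ S → kids S ≤ d) T
IsDAry⇒kids≤ d T dary v v∈ with dary v v∈
... | inj₁ leaf = ≤-trans (≤-reflexive leaf) z≤n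
... | inj₂ branch = ≤-reflexive branch

count-nodesL : (p : Word → Bool) (q : Tree → Word → Bool) (ts : List Tree) →
  (∀ j v → p (j ∷ v) ≡ q (θL j [] ts) v) → count p (nodesL 1 ts) ≡ sum (map (λ c → count (q c) (nodes c)) ts)
count-nodesL p q ts p≗q = from [] ts refl
  where
  from : ∀ pre cs → pre ++ cs ≡ ts →
    count p (nodesL (suc (length pre)) cs) ≡ sum (map (λ c → count (q c) (nodes c)) cs)
  from pre [] _ = refl
  from pre (c ∷ cs) refl = begin
      count p (map (i ∷_) (nodes c) ++ nodesL (suc i) cs)            ≡⟨ count-++ p (map (i ∷_) (nodes c)) (nodesL (suc i) cs) ⟩
      count p (map (i ∷_) (nodes c)) + count p (nodesL (suc i) cs)   ≡⟨ cong₂ _+_ first rest ⟩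
      count (q c) (nodes c) + sum (map (λ c → count (q c) (nodes c)) cs) ∎
    where
    open ≡-Reasoning
    i = suc (length pre)
    first : count p (map (i ∷_) (nodes c)) ≡ count (q c) (nodes c)
    first = trans (count-map p (i ∷_) (nodes c))
      (count-cong (λ v → trans (p≗q i v) (cong (λ T → q T v) (θL-at pre [] c cs))) (nodes c))
    rest : count p (nodesL (suc i) cs) ≡ sum (map (λ c → count (q c) (nodes c)) cs)
    rest = subst (λ k → count p (nodesL (suc k) cs) ≡ _) (length-++-comm pre (c ∷ []))
      (from (pre ∷ʳ c) cs (++-assoc pre (c ∷ []) cs))

-- Centrality along a path

eqℕ-refl : ∀ n → eqℕ n n ≡ true
eqℕ-refl zero = refl
eqℕ-refl (suc n) = eqℕ-refl n

eqℕ⇒≡ : ∀ m n → eqℕ m n ≡ true → m ≡ n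
eqℕ⇒≡ zero zero _ = refl
eqℕ⇒≡ (suc m) (suc n) e = cong suc (eqℕ⇒≡ m n e)

prefix?-refl : ∀ w → prefix? w w ≡ true
prefix?-refl [] = refl
prefix?-refl (a ∷ w) rewrite eqℕ-refl a = prefix?-refl w

prefix?-∷ʳ-self : ∀ w j → prefix? (w ∷ʳ j) w ≡ false
prefix?-∷ʳ-self [] j = refl
prefix?-∷ʳ-self (a ∷ w) j rewrite eqℕ-refl a = prefix?-∷ʳ-self w j

prefix?-∷ʳ : ∀ y w j → y ≢ w ∷ʳ j → prefix? y (w ∷ʳ j) ≡ prefix? y w
prefix?-∷ʳ [] w j _ = refl
prefix?-∷ʳ (a ∷ []) [] j y≢j with eqℕ a j in a≟j
... | true = ⊥-elim (y≢j (cong (_∷ []) (eqℕ⇒≡ a j a≟j)))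
... | false = refl
prefix?-∷ʳ (a ∷ _ ∷ _) [] j _ = ∧-zeroʳ (eqℕ a j)
prefix?-∷ʳ (a ∷ y) (b ∷ w) j y≢w∷ʳj with eqℕ a b in a≟b
... | false = refl
... | true = prefix?-∷ʳ y w j (λ y≡ → y≢w∷ʳj (cong₂ _∷_ (eqℕ⇒≡ a b a≟b) y≡))

factor-cong : ∀ t x w y → prefix? y x ≡ prefix? y w → factor t x y ≡ factor t w y
factor-cong t x w y e with prefix? y x | prefix? y w
factor-cong t x w y refl | false | false = refl
factor-cong t x w y refl | true | true = refl

factor-off-path : ∀ t u v → prefix? v u ≡ false → factor t u v ≡ size (θ v t)
factor-off-path t u v e with prefix? v u
factor-off-path t u v refl | false = refl

factor-∷ʳ-self : ∀ t w j → factor t (w ∷ʳ j) (w ∷ʳ j) ≡ size t ∸ size (θ (w ∷ʳ j) t)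
factor-∷ʳ-self t w j rewrite prefix?-refl (w ∷ʳ j) with w
... | [] = refl
... | _ ∷ _ = refl

product-exchange : {A : Set} (f g : A → ℕ) (x : A) (xs : List A) → Unique xs → x ∈ xs →
  (∀ y → y ≢ x → f y ≡ g y) → product (map f xs) * g x ≡ product (map g xs) * f x
product-exchange f g x (y ∷ ys) (x∉ys ∷ _) (here refl) f≗g =
  begin
    f x * product (map f ys) * g x ≡⟨ cong (λ p → f x * p * g x) (product-cong ys x∉ys) ⟩
    f x * product (map g ys) * g x ≡⟨ xy∙z≈zy∙x (f x) _ (g x) ⟩
    g x * product (map g ys) * f x ∎
  where
  open ≡-Reasoning
  product-cong : ∀ ys → All (x ≢_) ys → product (map f ys) ≡ product (map g ys)
  product-cong [] [] = refl
  product-cong (y ∷ ys) (x≢y ∷ x∉ys) = cong₂ _*_ (f≗g y (≢-sym x≢y)) (product-cong ys x∉ys)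
product-exchange f g x (y ∷ ys) (y∉ys ∷ ys!) (there x∈ys) f≗g
  rewrite f≗g y (λ { refl → All.lookup y∉ys x∈ys refl }) =
  trans (*-assoc (g y) _ (g x))
    (trans (cong (g y *_) (product-exchange f g x ys ys! x∈ys f≗g)) (sym (*-assoc (g y) _ (f x))))

-- Descending from w to its child x, only the factor of x itself changes: |θ_x t| becomes |t| − |θ_x t|.
φ-∷ʳ : ∀ t w j → (w ∷ʳ j) ∈ nodes t →
  φ t (w ∷ʳ j) * size (θ (w ∷ʳ j) t) ≡ φ t w * (size t ∸ size (θ (w ∷ʳ j) t))
φ-∷ʳ t w j x∈ = begin
    φ t x * size (θ x t)        ≡⟨ cong (φ t x *_) (factor-off-path t w x (prefix?-∷ʳ-self w j)) ⟨
    φ t x * factor t w x        ≡⟨ product-exchange (factor t x) (factor t w) x (nodes t) (nodes-unique t) x∈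
                                     (λ y y≢x → factor-cong t x w y (prefix?-∷ʳ y w j y≢x)) ⟩
    φ t w * factor t x x        ≡⟨ cong (φ t w *_) (factor-∷ʳ-self t w j) ⟩
    φ t w * (size t ∸ size (θ x t)) ∎
  where
  open ≡-Reasoning
  x = w ∷ʳ j

pathSize : Tree → Word → ℕ
pathSize T [] = 1
pathSize T (j ∷ v) = size (θ (j ∷ []) T) * pathSize (θ (j ∷ []) T) v

pathCoSize : ℕ → Tree → Word → ℕ
pathCoSize n T [] = 1
pathCoSize n T (j ∷ v) = (n ∸ size (θ (j ∷ []) T)) * pathCoSize n (θ (j ∷ []) T) v

φ-++ : ∀ t u v → (u ++ v) ∈ nodes t →
  φ t (u ++ v) * pathSize (θ u t) v ≡ φ t u * pathCoSize (size t) (θ u t) v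
φ-++ t u [] _ = cong (λ w → φ t w * 1) (++-identityʳ u)
φ-++ t u (j ∷ v) u++j∷v∈ = begin
    φ t (u ++ j ∷ v) * (size c * pathSize c v)      ≡⟨ cong (λ w → φ t w * (size c * pathSize c v)) (++-assoc u (j ∷ []) v) ⟨
    φ t (u′ ++ v) * (size c * pathSize c v)          ≡⟨ x∙yz≈y∙xz (φ t (u′ ++ v)) (size c) _ ⟩
    size c * (φ t (u′ ++ v) * pathSize c v)         ≡⟨ cong (size c *_) descend ⟩
    size c * (φ t u′ * pathCoSize n c v)             ≡⟨ x∙yz≈yx∙z (size c) (φ t u′) _ ⟩
    φ t u′ * size c * pathCoSize n c v               ≡⟨ cong (_* pathCoSize n c v) step ⟩
    φ t u * (n ∸ size c) * pathCoSize n c v          ≡⟨ *-assoc (φ t u) _ _ ⟩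
    φ t u * ((n ∸ size c) * pathCoSize n c v)        ∎
  where
  open ≡-Reasoning
  n = size t
  u′ = u ∷ʳ j
  c = θ (j ∷ []) (θ u t)
  u′++v∈ : (u′ ++ v) ∈ nodes t
  u′++v∈ = subst (_∈ nodes t) (sym (++-assoc u (j ∷ []) v)) u++j∷v∈
  θu′≡c : θ u′ t ≡ c
  θu′≡c = θ-++ u (j ∷ []) t
  descend : φ t (u′ ++ v) * pathSize c v ≡ φ t u′ * pathCoSize n c v
  descend = subst (λ c → φ t (u′ ++ v) * pathSize c v ≡ φ t u′ * pathCoSize n c v) θu′≡c
              (φ-++ t u′ v u′++v∈)
  step : φ t u′ * size c ≡ φ t u * (n ∸ size c)
  step = subst (λ c → φ t u′ * size c ≡ φ t u * (n ∸ size c)) θu′≡c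
           (φ-∷ʳ t u j (∈-nodes-prefix u′ v t u′++v∈))

pathSize≥1 : ∀ T v → 1 ≤ pathSize T v
pathSize≥1 T [] = ≤-refl
pathSize≥1 T (j ∷ v) = *-mono-≤ (size≥1 (θ (j ∷ []) T)) (pathSize≥1 (θ (j ∷ []) T) v)

φ[]≥1 : ∀ t → 1 ≤ φ t []
φ[]≥1 t = product-map≥1 (factor t []) (nodes t) factor≥1
  where
  factor≥1 : ∀ v → v ∈ nodes t → 1 ≤ factor t [] v
  factor≥1 [] _ = ≤-refl
  factor≥1 (j ∷ v) _ = size≥1 (θ (j ∷ v) t)

pathRatio-bound : ∀ t u v e → (u ++ v) ∈ nodes t → .{{NonZero (φ t u)}} → φ t (u ++ v) ≤ 2 ^ e * φ t u →
  pathCoSize (size t) (θ u t) v ≤ 2 ^ e * pathSize (θ u t) v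
pathRatio-bound t u v e u++v∈ φ-bound = *-cancelˡ-≤ (φ t u) (begin
    φ t u * pn              ≡⟨ φ-++ t u v u++v∈ ⟨
    φ t (u ++ v) * ps       ≤⟨ *-monoˡ-≤ ps φ-bound ⟩
    2 ^ e * φ t u * ps      ≡⟨ xy∙z≈y∙xz (2 ^ e) (φ t u) ps ⟩
    φ t u * (2 ^ e * ps)    ∎)
  where
  open ≤-Reasoning
  ps = pathSize (θ u t) v
  pn = pathCoSize (size t) (θ u t) v

-- Budget potential

-- For b = q·r + ρ with ρ < r, pot b = (r + ρ)·2^q grows by Δpot b = 2^q per unit of budget, yet
-- pot b ≤ 2r·Δpot b, and pot (r·r) ≤ 2r·2^r.
module Potential (r : ℕ) .{{_ : NonZero r}} where

  carry : ℕ × ℕ → ℕ × ℕ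
  carry (q , ρ) with suc ρ ≟ r
  ... | yes _ = suc q , 0
  ... | no _ = q , suc ρ

  quotRem : ℕ → ℕ × ℕ
  quotRem zero = 0 , 0
  quotRem (suc b) = carry (quotRem b)

  quotRem-correct : ∀ b → proj₂ (quotRem b) < r × proj₁ (quotRem b) * r + proj₂ (quotRem b) ≡ b
  quotRem-correct zero = >-nonZero⁻¹ r , refl
  quotRem-correct (suc b) with quotRem b | quotRem-correct b
  ... | q , ρ | ρ<r , qr+ρ≡b with suc ρ ≟ r
  ... | yes 1+ρ≡r = >-nonZero⁻¹ r , (begin
      suc q * r + 0   ≡⟨ +-identityʳ (suc q * r) ⟩
      r + q * r       ≡⟨ cong (_+ q * r) 1+ρ≡r ⟨
      suc ρ + q * r   ≡⟨ cong suc (+-comm ρ (q * r)) ⟩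
      suc (q * r + ρ) ≡⟨ cong suc qr+ρ≡b ⟩
      suc b           ∎)
    where open ≡-Reasoning
  ... | no 1+ρ≢r = ≤∧≢⇒< ρ<r 1+ρ≢r , trans (+-suc (q * r) ρ) (cong suc qr+ρ≡b)

  Δpot : ℕ → ℕ
  Δpot b = 2 ^ proj₁ (quotRem b)

  pot : ℕ → ℕ
  pot b = (r + proj₂ (quotRem b)) * Δpot b

  pot-suc : ∀ b → pot (suc b) ≡ pot b + Δpot b
  pot-suc b with quotRem b
  ... | q , ρ with suc ρ ≟ r
  ... | yes 1+ρ≡r = begin
      (r + 0) * (2 * 2 ^ q)     ≡⟨ double r (2 ^ q) ⟩
      (r + r) * 2 ^ q           ≡⟨ cong (λ s → (r + s) * 2 ^ q) 1+ρ≡r ⟨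
      (r + suc ρ) * 2 ^ q       ≡⟨ [m+1+n]*o≡[m+n]*o+o r ρ (2 ^ q) ⟩
      (r + ρ) * 2 ^ q + 2 ^ q   ∎
    where
    open ≡-Reasoning
    double : ∀ r x → (r + 0) * (2 * x) ≡ (r + r) * x
    double = solve-∀
  ... | no _ = [m+1+n]*o≡[m+n]*o+o r ρ (2 ^ q)

  Δpot≥1 : ∀ b → 1 ≤ Δpot b
  Δpot≥1 b = m^n>0 2 (proj₁ (quotRem b))

  Δpot-suc : ∀ b → Δpot b ≤ Δpot (suc b)
  Δpot-suc b with quotRem b
  ... | q , ρ with suc ρ ≟ r
  ... | yes _ = m≤m+n (2 ^ q) (2 ^ q + 0)
  ... | no _ = ≤-refl

  Δpot-+ : ∀ c k → Δpot c ≤ Δpot (c + k)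
  Δpot-+ c zero = ≤-reflexive (cong Δpot (sym (+-identityʳ c)))
  Δpot-+ c (suc k) rewrite +-suc c k = ≤-trans (Δpot-+ c k) (Δpot-suc (c + k))

  pot-+ : ∀ c k → pot c + k * Δpot c ≤ pot (c + k)
  pot-+ c zero rewrite +-identityʳ c | +-identityʳ (pot c) = ≤-refl
  pot-+ c (suc k) rewrite +-suc c k | pot-suc (c + k) = begin
      pot c + (Δpot c + k * Δpot c)   ≡⟨ x+[y+z]≡x+z+y (pot c) (Δpot c) _ ⟩
      pot c + k * Δpot c + Δpot c     ≤⟨ +-mono-≤ (pot-+ c k) (Δpot-+ c k) ⟩
      pot (c + k) + Δpot (c + k)      ∎
    where open ≤-Reasoning

  pot-mono : ∀ {b b′} → b ≤ b′ → pot b ≤ pot b′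
  pot-mono {b} {b′} b≤b′ = subst (λ x → pot b ≤ pot x) (m+[n∸m]≡n b≤b′)
    (≤-trans (m≤m+n (pot b) _) (pot-+ b (b′ ∸ b)))

  pot≤2r*Δpot : ∀ b → pot b ≤ 2 * r * Δpot b
  pot≤2r*Δpot b = *-monoˡ-≤ (Δpot b) (begin
      r + proj₂ (quotRem b) ≤⟨ +-monoʳ-≤ r (<⇒≤ (proj₁ (quotRem-correct b))) ⟩
      r + r                 ≡⟨ cong (r +_) (+-identityʳ r) ⟨
      2 * r                 ∎)
    where open ≤-Reasoning

  pot≥1 : ∀ b → 1 ≤ pot b
  pot≥1 b = *-mono-≤ (≤-trans (>-nonZero⁻¹ r) (m≤m+n r _)) (Δpot≥1 b)

  pot≤2r*2^r : ∀ b → b ≤ r * r → pot b ≤ 2 * r * 2 ^ r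
  pot≤2r*2^r b b≤r² = ≤-trans (pot≤2r*Δpot b) (*-monoʳ-≤ (2 * r) (^-monoʳ-≤ 2 q≤r))
    where
    q = proj₁ (quotRem b)
    q≤r : q ≤ r
    q≤r = *-cancelʳ-≤ q r r (begin
        q * r                         ≤⟨ m≤m+n (q * r) _ ⟩
        q * r + proj₂ (quotRem b)     ≡⟨ proj₂ (quotRem-correct b) ⟩
        b                             ≤⟨ b≤r² ⟩
        r * r                         ∎)
      where open ≤-Reasoning

-- Counting good nodes

-- good K T L b v: on the way from the root of T to v, entering a child c costs 1 + level, where the
-- level counts the light steps so far, capped at K (c is light if 2|c| ≤ |parent|); v is good if
-- the total cost is at most b.
level : ℕ → ℕ → Tree → ℕ → ℕ
level K S c L with 2 * size c ≤? S
... | yes _ = suc L ⊓ K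
... | no _ = L

mutual
  good : ℕ → Tree → ℕ → ℕ → Word → Bool
  good K T L b [] = true
  good K T L b (j ∷ v) = goodChild K (size T) (θ (j ∷ []) T) L b v

  goodChild : ℕ → ℕ → Tree → ℕ → ℕ → Word → Bool
  goodChild K S c L b v =
    does (suc (level K S c L) ≤? b) ∧ good K c (level K S c L) (b ∸ suc (level K S c L)) v

heavy : ℕ → Tree → ℕ
heavy S c with 2 * size c ≤? S
... | yes _ = 0
... | no _ = 1

heavy*[1+S]≤2*size : ∀ S cs → sum (map (heavy S) cs) * suc S ≤ 2 * sum (map size cs)
heavy*[1+S]≤2*size S [] = z≤n
heavy*[1+S]≤2*size S (c ∷ cs) = begin
    (heavy S c + sum (map (heavy S) cs)) * suc S              ≡⟨ *-distribʳ-+ (suc S) (heavy S c) _ ⟩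
    heavy S c * suc S + sum (map (heavy S) cs) * suc S        ≤⟨ +-mono-≤ heavy-c (heavy*[1+S]≤2*size S cs) ⟩
    2 * size c + 2 * sum (map size cs)                        ≡⟨ *-distribˡ-+ 2 (size c) _ ⟨
    2 * (size c + sum (map size cs))                          ∎
  where
  open ≤-Reasoning
  heavy-c : heavy S c * suc S ≤ 2 * size c
  heavy-c with 2 * size c ≤? S
  ... | yes _ = z≤n
  ... | no 2c≰S = ≤-trans (≤-reflexive (*-identityˡ (suc S))) (≰⇒> 2c≰S)

at-most-one-heavy : ∀ ts → sum (map (heavy (size (node ts))) ts) ≤ 1
at-most-one-heavy ts = ≤1 h (subst (λ n → h * suc n ≤ 2 * s) (size-node ts) (heavy*[1+S]≤2*size S ts))
  where
  S = size (node ts)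
  s = sum (map size ts)
  h = sum (map (heavy S) ts)
  ≤1 : ∀ k → k * suc (suc s) ≤ 2 * s → k ≤ 1
  ≤1 zero _ = z≤n
  ≤1 (suc zero) _ = s≤s z≤n
  ≤1 (suc (suc k)) bound =
    contradiction (≤-trans (*-monoˡ-≤ (suc (suc s)) (m≤m+n 2 k)) bound)
      (<⇒≱ (*-monoʳ-< 2 (m<n⇒m<1+n (n<1+n s))))

level-≥ : ∀ K S c L → L ≤ K → L ≤ level K S c L
level-≥ K S c L L≤K with 2 * size c ≤? S
... | yes _ = ⊓-glb (n≤1+n L) L≤K
... | no _ = ≤-refl

level-≤ : ∀ K S c L → L ≤ K → level K S c L ≤ K
level-≤ K S c L L≤K with 2 * size c ≤? S
... | yes _ = m⊓n≤n (suc L) K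
... | no _ = L≤K

goodChild-exhausted : ∀ K S c L b → L ≤ K → ¬ suc L ≤ b → ∀ v → goodChild K S c L b v ≡ false
goodChild-exhausted K S c L b L≤K L≮b v
  rewrite dec-false (suc (level K S c L) ≤? b) (λ lvl<b → L≮b (≤-trans (s≤s (level-≥ K S c L L≤K)) lvl<b)) = refl

module Counting (d r : ℕ) .{{_ : NonZero d}} .{{_ : NonZero r}} where
  open Potential r

  K V : ℕ
  K = 2 * r * (2 * d)
  V = 2 * 4 ^ K

  F W : ℕ → ℕ
  F L = (K + L) !
  W L = K ! * L !

  -- F L / W L = C(K + L, L): the bound reads  count ≤ V · pot b / C(K + L, L).
  CountBound : Tree → Set
  CountBound T = ∀ L b → L ≤ K → count (good K T L b) (nodes T) * F L ≤ V * pot b * W L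

  2F≤VW : ∀ L → L ≤ K → 2 * F L ≤ V * W L
  2F≤VW L L≤K = subst (2 * F L ≤_) (sym (*-assoc 2 (4 ^ K) (W L))) (*-monoʳ-≤ 2 ([m+n]!≤4^m*m!*n! K L L≤K))

  raise-level : ∀ L X Y → L ≤ K → X * F (suc L ⊓ K) ≤ Y * W (suc L ⊓ K) → K * (X * F L) ≤ suc L * (Y * W L)
  raise-level L X Y L≤K bound with suc L ≤? K
  ... | yes L<K = begin
      K * (X * F L)                 ≤⟨ *-monoˡ-≤ (X * F L) (m≤n⇒m≤1+n (m≤m+n K L)) ⟩
      suc (K + L) * (X * F L)       ≡⟨ x∙yz≈y∙xz (suc (K + L)) X (F L) ⟩
      X * (suc (K + L)) !           ≡⟨ cong (λ n → X * n !) (+-suc K L) ⟨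
      X * F (suc L)                 ≡⟨ cong (λ L′ → X * F L′) (m≤n⇒m⊓n≡m L<K) ⟨
      X * F (suc L ⊓ K)             ≤⟨ bound ⟩
      Y * W (suc L ⊓ K)             ≡⟨ cong (λ L′ → Y * W L′) (m≤n⇒m⊓n≡m L<K) ⟩
      Y * (K ! * (suc L * L !))     ≡⟨ regroup Y (K !) (suc L) (L !) ⟩
      suc L * (Y * W L)             ∎
    where
    open ≤-Reasoning
    regroup : ∀ y k l f → y * (k * (l * f)) ≡ l * (y * (k * f))
    regroup = solve-∀
  ... | no L≮K rewrite ≤-antisym L≤K (≮⇒≥ L≮K) = begin
      K * (X * F K)                 ≤⟨ *-monoˡ-≤ (X * F K) (n≤1+n K) ⟩
      suc K * (X * F K)             ≤⟨ *-monoʳ-≤ (suc K) (subst (λ L′ → X * F L′ ≤ Y * W L′) (m≥n⇒m⊓n≡n (n≤1+n K)) bound) ⟩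
      suc K * (Y * W K)             ∎
    where open ≤-Reasoning

  heavyShare lightShare : ℕ → ℕ → ℕ
  heavyShare L b = 2 * d * (V * pot (b ∸ suc L) * W L)
  lightShare L b = V * Δpot (b ∸ suc L) * suc L * W L

  share-bound : ∀ S c L b X → L ≤ K →
    X * F (level K S c L) ≤ V * pot (b ∸ suc L) * W (level K S c L) →
    X * (2 * d * F L) ≤ heavy S c * heavyShare L b + lightShare L b
  share-bound S c L b X L≤K with 2 * size c ≤? S
  ... | no _ = λ bound → begin
      X * (2 * d * F L)               ≡⟨ x∙yz≈y∙xz X (2 * d) (F L) ⟩
      2 * d * (X * F L)               ≤⟨ *-monoʳ-≤ (2 * d) bound ⟩
      heavyShare L b                  ≤⟨ m≤m+n (heavyShare L b) (lightShare L b) ⟩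
      heavyShare L b + lightShare L b ≡⟨ cong (_+ lightShare L b) (*-identityˡ (heavyShare L b)) ⟨
      1 * heavyShare L b + lightShare L b ∎
    where open ≤-Reasoning
  ... | yes _ = λ bound → *-cancelˡ-≤ (2 * r) {{m*n≢0 2 r}} (begin
      2 * r * (X * (2 * d * F L))                      ≡⟨ regroup (2 * r) (2 * d) X (F L) ⟩
      K * (X * F L)                                    ≤⟨ raise-level L X (V * pot b′) L≤K bound ⟩
      suc L * (V * pot b′ * W L)                       ≤⟨ *-monoʳ-≤ (suc L) (*-monoˡ-≤ (W L) (*-monoʳ-≤ V (pot≤2r*Δpot b′))) ⟩
      suc L * (V * (2 * r * Δpot b′) * W L)            ≡⟨ regroup′ (suc L) V (2 * r) (Δpot b′) (W L) ⟩
      2 * r * lightShare L b                           ∎)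
    where
    open ≤-Reasoning
    b′ = b ∸ suc L
    regroup : ∀ a e x f → a * (x * (e * f)) ≡ a * e * (x * f)
    regroup = solve-∀
    regroup′ : ∀ l v a p w → l * (v * (a * p) * w) ≡ a * (v * p * l * w)
    regroup′ = solve-∀

  goodChild-count : ∀ S c L b → CountBound c → L ≤ K →
    count (goodChild K S c L b) (nodes c) * F (level K S c L) ≤ V * pot (b ∸ suc L) * W (level K S c L)
  goodChild-count S c L b c-bound L≤K = begin
      count (goodChild K S c L b) (nodes c) * F L′         ≤⟨ *-monoˡ-≤ (F L′) (count-∧ʳ _ (good K c L′ (b ∸ suc L′)) (nodes c)) ⟩
      count (good K c L′ (b ∸ suc L′)) (nodes c) * F L′    ≤⟨ c-bound L′ (b ∸ suc L′) (level-≤ K S c L L≤K) ⟩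
      V * pot (b ∸ suc L′) * W L′                          ≤⟨ *-monoˡ-≤ (W L′) (*-monoʳ-≤ V (pot-mono (∸-monoʳ-≤ b (s≤s (level-≥ K S c L L≤K))))) ⟩
      V * pot (b ∸ suc L) * W L′                           ∎
    where
    open ≤-Reasoning
    L′ = level K S c L

  exhausted-bound : ∀ ts L b → L ≤ K → ¬ suc L ≤ b → count (good K (node ts) L b) (nodes (node ts)) * F L ≤ V * pot b * W L
  exhausted-bound ts L b L≤K L≮b = begin
      suc (count (good K (node ts) L b) (nodesL 1 ts)) * F L
                      ≡⟨ cong (λ n → suc n * F L) (count-none (All.map exhausted (nodesL-startsFrom 1 ts))) ⟩
      1 * F L         ≤⟨ *-monoˡ-≤ (F L) (s≤s (z≤n {1})) ⟩
      2 * F L         ≤⟨ 2F≤VW L L≤K ⟩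
      V * W L         ≤⟨ *-monoˡ-≤ (W L) (m≤m*n V (pot b) {{>-nonZero (pot≥1 b)}}) ⟩
      V * pot b * W L ∎
    where
    open ≤-Reasoning
    exhausted : ∀ {w} → StartsFrom 1 w → good K (node ts) L b w ≡ false
    exhausted {j ∷ v} _ = goodChild-exhausted K (size (node ts)) (θL j [] ts) L b L≤K L≮b v

  root-share : ∀ L b → L ≤ K → 2 * d * F L ≤ d * lightShare L b
  root-share L b L≤K = begin
      2 * d * F L                        ≡⟨ *-assoc 2 d (F L) ⟩
      2 * (d * F L)                      ≡⟨ x∙yz≈y∙xz 2 d (F L) ⟩
      d * (2 * F L)                      ≤⟨ *-monoʳ-≤ d (2F≤VW L L≤K) ⟩
      d * (V * W L)                      ≤⟨ *-monoʳ-≤ d (*-monoˡ-≤ (W L) (m≤m*n V (Δpot b′ * suc L) {{Δpot*[1+L]≢0}})) ⟩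
      d * (V * (Δpot b′ * suc L) * W L)  ≡⟨ cong (λ n → d * (n * W L)) (*-assoc V (Δpot b′) (suc L)) ⟨
      d * lightShare L b                 ∎
    where
    open ≤-Reasoning
    b′ = b ∸ suc L
    Δpot*[1+L]≢0 : NonZero (Δpot b′ * suc L)
    Δpot*[1+L]≢0 = >-nonZero (*-mono-≤ (Δpot≥1 b′) (s≤s z≤n))

  children-share : ∀ ts L b → length ts ≤ d → All CountBound ts → L ≤ K → suc L ≤ b →
    sum (map (λ c → count (goodChild K (size (node ts)) c L b) (nodes c)) ts) * (2 * d * F L)
      ≤ heavyShare L b + d * lightShare L b
  children-share ts L b len≤d c-bounds L≤K L<b = begin
      sum (map X ts) * (2 * d * F L)          ≤⟨ sum-map-bound X (heavy S) (2 * d * F L) A B ts (All.map (λ {c} → child-share {c}) c-bounds) ⟩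
      sum (map (heavy S) ts) * A + length ts * B
                                              ≤⟨ +-mono-≤ (*-monoˡ-≤ A (at-most-one-heavy ts)) (*-monoˡ-≤ B len≤d) ⟩
      1 * A + d * B                           ≡⟨ cong (_+ d * B) (*-identityˡ A) ⟩
      A + d * B                               ∎
    where
    open ≤-Reasoning
    S = size (node ts)
    A = heavyShare L b
    B = lightShare L b
    X : Tree → ℕ
    X c = count (goodChild K S c L b) (nodes c)
    child-share : ∀ {c} → CountBound c → X c * (2 * d * F L) ≤ heavy S c * A + B
    child-share {c} c-bound = share-bound S c L b (X c) L≤K (goodChild-count S c L b c-bound L≤K)

  node-bound : ∀ ts → length ts ≤ d → All CountBound ts → CountBound (node ts)
  node-bound ts len≤d c-bounds L b L≤K with suc L ≤? b
  ... | no L≮b = exhausted-bound ts L b L≤K L≮b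
  ... | yes L<b = *-cancelˡ-≤ (2 * d) {{m*n≢0 2 d}} (begin
      2 * d * (suc (count (good K (node ts) L b) (nodesL 1 ts)) * F L)
                                                     ≡⟨ cong (λ n → 2 * d * (suc n * F L)) children-count ⟩
      2 * d * (suc X * F L)                          ≡⟨ regroup (2 * d) X (F L) ⟩
      2 * d * F L + X * (2 * d * F L)                ≤⟨ +-mono-≤ (root-share L b L≤K) (children-share ts L b len≤d c-bounds L≤K L<b) ⟩
      d * B + (A + d * B)                            ≡⟨ regroup′ d V (pot b′) (Δpot b′) (suc L) (W L) ⟩
      2 * d * (V * (pot b′ + suc L * Δpot b′) * W L) ≤⟨ *-monoʳ-≤ (2 * d) (*-monoˡ-≤ (W L) (*-monoʳ-≤ V spend)) ⟩
      2 * d * (V * pot b * W L)                      ∎)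
    where
    open ≤-Reasoning
    S = size (node ts)
    b′ = b ∸ suc L
    A = heavyShare L b
    B = lightShare L b
    X = sum (map (λ c → count (goodChild K S c L b) (nodes c)) ts)
    children-count : count (good K (node ts) L b) (nodesL 1 ts) ≡ X
    children-count = count-nodesL (good K (node ts) L b) (λ c → goodChild K S c L b) ts (λ _ _ → refl)
    regroup : ∀ e x f → e * (suc x * f) ≡ e * f + x * (e * f)
    regroup = solve-∀
    regroup′ : ∀ d v p δ l w → d * (v * δ * l * w) + (2 * d * (v * p * w) + d * (v * δ * l * w)) ≡ 2 * d * (v * (p + l * δ) * w)
    regroup′ = solve-∀
    spend : pot b′ + suc L * Δpot b′ ≤ pot b
    spend = subst (λ n → pot b′ + suc L * Δpot b′ ≤ pot n) (m∸n+n≡m L<b) (pot-+ b′ (suc L))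

  mutual
    count-good-bound : ∀ T → AllSubtrees (λ S → kids S ≤ d) T → CountBound T
    count-good-bound (node ts) kids≤d =
      node-bound ts (kids≤d [] (here refl)) (count-good-bound-all (AllSubtrees-children {λ S → kids S ≤ d} [] ts kids≤d))

    count-good-bound-all : ∀ {ts} → All (AllSubtrees (λ S → kids S ≤ d)) ts → All CountBound ts
    count-good-bound-all [] = []
    count-good-bound-all {c ∷ _} (kids≤d ∷ kids≤ds) = count-good-bound c kids≤d ∷ count-good-bound-all kids≤ds

-- From centrality to good nodes

module Descent (K n a : ℕ) (3a≤n : 3 * a ≤ n) where

  2a≤n∸s : ∀ {s} → s ≤ a → 2 * a ≤ n ∸ s
  2a≤n∸s {s} s≤a = begin
      2 * a           ≡⟨ m+n∸n≡m (2 * a) a ⟨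
      2 * a + a ∸ a   ≤⟨ ∸-monoˡ-≤ a (subst (_≤ n) (2a+a≡3a a) 3a≤n) ⟩
      n ∸ a           ≤⟨ ∸-monoʳ-≤ n s≤a ⟩
      n ∸ s           ∎
    where
    open ≤-Reasoning
    2a+a≡3a : ∀ a → 3 * a ≡ 2 * a + a
    2a+a≡3a = solve-∀

  pathSize≤pathCoSize : ∀ T v → size T ≤ a → pathSize T v ≤ pathCoSize n T v
  pathSize≤pathCoSize T [] _ = ≤-refl
  pathSize≤pathCoSize T (j ∷ v) T≤a =
    *-mono-≤ (≤-trans (m≤n*m (size c) 2) (≤-trans (*-monoʳ-≤ 2 c≤a) (2a≤n∸s c≤a))) (pathSize≤pathCoSize c v c≤a)
    where
    c = θ (j ∷ []) T
    c≤a : size c ≤ a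
    c≤a = ≤-trans (size-θ≤ (j ∷ []) T) T≤a

  level-size : ∀ S c L → size c ≤ S → 2 ^ L * S ≤ a → 2 ^ level K S c L * size c ≤ a
  level-size S c L c≤S 2^L*S≤a with 2 * size c ≤? S
  ... | no _ = ≤-trans (*-monoʳ-≤ (2 ^ L) c≤S) 2^L*S≤a
  ... | yes 2c≤S = begin
      2 ^ (suc L ⊓ K) * size c  ≤⟨ *-monoˡ-≤ (size c) (^-monoʳ-≤ 2 (m⊓n≤m (suc L) K)) ⟩
      2 * 2 ^ L * size c        ≡⟨ xy∙z≈y∙xz 2 (2 ^ L) (size c) ⟩
      2 ^ L * (2 * size c)      ≤⟨ *-monoʳ-≤ (2 ^ L) 2c≤S ⟩
      2 ^ L * S                 ≤⟨ 2^L*S≤a ⟩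
      a                         ∎
    where open ≤-Reasoning

  good-from-pathRatio : ∀ T v L b → 2 ^ L * size T ≤ a → pathCoSize n T v ≤ 2 ^ b * pathSize T v → good K T L b v ≡ true
  good-from-pathRatio T [] L b _ _ = refl
  good-from-pathRatio T (j ∷ v) L b 2^L*T≤a ratio =
    cong₂ _∧_ (dec-true (suc L′ ≤? b) (proj₁ peeled)) (good-from-pathRatio c v L′ (b ∸ suc L′) 2^L′*c≤a (proj₂ peeled))
    where
    c = θ (j ∷ []) T
    L′ = level K (size T) c L
    2^L′*c≤a : 2 ^ L′ * size c ≤ a
    2^L′*c≤a = level-size (size T) c L (size-θ≤ (j ∷ []) T) 2^L*T≤a
    c≤a : size c ≤ a
    c≤a = ≤-trans (m≤n*m (size c) (2 ^ L′) {{m^n≢0 2 L′}}) 2^L′*c≤a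
    far : 2 ^ suc L′ * size c ≤ n ∸ size c
    far = begin
      2 * 2 ^ L′ * size c     ≡⟨ *-assoc 2 (2 ^ L′) (size c) ⟩
      2 * (2 ^ L′ * size c)   ≤⟨ *-monoʳ-≤ 2 2^L′*c≤a ⟩
      2 * a                   ≤⟨ 2a≤n∸s c≤a ⟩
      n ∸ size c              ∎
      where open ≤-Reasoning
    peeled : suc L′ ≤ b × pathCoSize n c v ≤ 2 ^ (b ∸ suc L′) * pathSize c v
    peeled = peel-factor {{>-nonZero (size≥1 c)}} {{>-nonZero (pathSize≥1 c v)}}
               far (pathSize≤pathCoSize c v c≤a) ratio

countBelowRoot-bound : ∀ d m t u → .{{_ : NonZero d}} → u ∈ nodes t → IsDAry d (θ u t) → 3 * size (θ u t) ≤ size t →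
  φ t [] ≤ 2 ^ (m * m) * minφ t → countBelowRoot t u ≤ Counting.V d (suc m) * Potential.pot (suc m) (m * m)
countBelowRoot-bound d m t u u∈t dary 3a≤n Φ-bound = *-cancelʳ-≤ _ _ (K !) {{K !≢0}} (begin
    countBelowRoot t u * K !                    ≤⟨ *-monoˡ-≤ (K !) selected≤good ⟩
    count (good K T 0 M) (nodes T) * K !        ≡⟨ cong (λ k → count (good K T 0 M) (nodes T) * k !) (+-identityʳ K) ⟨
    count (good K T 0 M) (nodes T) * F 0        ≤⟨ count-good-bound T (IsDAry⇒kids≤ d T dary) 0 M z≤n ⟩
    V * pot M * W 0                             ≡⟨ cong (V * pot M *_) (*-identityʳ (K !)) ⟩
    V * pot M * K !                             ∎)
  where
  open Counting d (suc m)
  open Potential (suc m)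
  open Descent K (size t) (size (θ u t)) 3a≤n
  open ≤-Reasoning
  T = θ u t
  M = m * m
  root≤ : φ t [] ≤ 2 ^ M * φ t u
  root≤ = ≤-trans Φ-bound (*-monoʳ-≤ (2 ^ M) (foldr-⊓-map≤ (φ t) (φ t []) u∈t))
  φu≢0 : NonZero (φ t u)
  φu≢0 = ≢-nonZero λ φu≡0 →
    contradiction (≤-trans (φ[]≥1 t) (≤-trans root≤ (≤-reflexive (trans (cong (2 ^ M *_) φu≡0) (*-zeroʳ (2 ^ M)))))) λ ()
  selected⇒good : ∀ v → v ∈ nodes T → φ t (u ++ v) ≤ φ t [] → good K T 0 M v ≡ true
  selected⇒good v v∈T φ≤root = good-from-pathRatio T v 0 M (≤-reflexive (+-identityʳ (size T)))
    (pathRatio-bound t u v M (++-∈-nodes⁺ u v t u∈t v∈T) {{φu≢0}} (≤-trans φ≤root root≤))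
  selected≤good : countBelowRoot t u ≤ count (good K T 0 M) (nodes T)
  selected≤good = length-filter≤count (λ v → φ t (u ++ v) ≤? φ t []) (good K T 0 M) (nodes T) selected⇒good

constant-bound : ∀ d m → .{{_ : NonZero d}} → Counting.V d (suc m) * Potential.pot (suc m) (m * m) ≤ (2 ^ (4 + 8 * d)) ^ suc m
constant-bound d m = begin
    2 * 4 ^ K * pot (m * m)              ≤⟨ *-monoʳ-≤ (2 * 4 ^ K) (pot≤2r*2^r (m * m) (*-mono-≤ (n≤1+n m) (n≤1+n m))) ⟩
    2 * 4 ^ K * (2 * r * 2 ^ r)          ≤⟨ *-monoʳ-≤ (2 * 4 ^ K) (*-monoˡ-≤ (2 ^ r) (*-monoʳ-≤ 2 (n≤2^n r))) ⟩
    2 * 4 ^ K * (2 * 2 ^ r * 2 ^ r)      ≡⟨ cong (λ x → 2 * x * (2 * 2 ^ r * 2 ^ r)) (^-*-assoc 2 2 K) ⟩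
    2 * 2 ^ (2 * K) * (2 * 2 ^ r * 2 ^ r) ≡⟨ regroup (2 ^ (2 * K)) (2 ^ r) ⟩
    2 ^ 2 * (2 ^ (2 * K) * (2 ^ r * 2 ^ r)) ≡⟨ powers ⟨
    2 ^ (2 + (2 * K + (r + r)))          ≤⟨ ^-monoʳ-≤ 2 exponent ⟩
    2 ^ ((4 + 8 * d) * r)                ≡⟨ ^-*-assoc 2 (4 + 8 * d) r ⟨
    (2 ^ (4 + 8 * d)) ^ r                ∎
  where
  open Counting d (suc m)
  open Potential (suc m)
  open ≤-Reasoning
  r = suc m
  regroup : ∀ x y → 2 * x * (2 * y * y) ≡ 4 * (x * (y * y))
  regroup = solve-∀
  powers : 2 ^ (2 + (2 * K + (r + r))) ≡ 2 ^ 2 * (2 ^ (2 * K) * (2 ^ r * 2 ^ r))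
  powers = trans (^-distribˡ-+-* 2 2 (2 * K + (r + r))) (cong (2 ^ 2 *_) (trans (^-distribˡ-+-* 2 (2 * K) (r + r)) (cong (2 ^ (2 * K) *_) (^-distribˡ-+-* 2 r r))))
  exponent : 2 + (2 * K + (r + r)) ≤ (4 + 8 * d) * r
  exponent = subst (2 + (2 * K + (r + r)) ≤_) (sym (slack d m)) (m≤m+n _ (2 * m))
    where
    slack : ∀ d m → (4 + 8 * d) * suc m ≡ 2 + (2 * (2 * suc m * (2 * d)) + (suc m + suc m)) + 2 * m
    slack = solve-∀

proposition3p5 : (d : ℕ) → 2 ≤ d →
    Σ ℕ λ C → 1 ≤ C ×
      ((t : Tree) (u : Word) → u ∈ nodes t →
        IsDAry d (θ u t) → 3 * size (θ u t) ≤ size t →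
        (m : ℕ) → φ t [] ≤ 2 ^ (m * m) * minφ t →
        countBelowRoot t u ≤ C ^ (suc m))
proposition3p5 d 2≤d = 2 ^ (4 + 8 * d) , m^n>0 2 (4 + 8 * d) ,
  λ t u u∈t dary small m Φ-bound →
    ≤-trans (countBelowRoot-bound d m t u u∈t dary small Φ-bound) (constant-bound d m)
  where
  instance
    d≢0 : NonZero d
    d≢0 = >-nonZero (≤-trans (s≤s z≤n) 2≤d)
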